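{- Let $\mu$ be a partition and let $\lambda$ and $\nu$ be finite sequences of integers, where $\mu$ is also written as a finite sequence (with possibly some trailing zeros), and assume $\ell\ell(\lambda)=\ell\ell(\mu)=\ell\ell(\nu)$. Then the sequence with general term $b_{\lambda+(n),\,\mu}^{\nu+n\cdot\mu}$ ($n\ge 0$) is constant for $n \geq |\lambda|\cdot\|\mu\| - \|\nu\| - \lambda_1$.
   Context: For a finite sequence of integers $\alpha=(\alpha_1,\dots,\alpha_k)$, $h_\alpha=h_{\alpha_1}\cdots h_{\alpha_k}$ where $h_r$ is the complete homogeneous symmetric function ($h_0=1$, $h_r=0$ for $r<0$). For a partition $\mu$ and finite sequences of integers $\lambda,\nu$, $b_{\lambda,\mu}^{\nu}=\langle h_\lambda[s_\mu],h_\nu\rangle$, where $s_\mu$ is the Schur function, $f[g]$ is plethysm and $\langle\cdot,\cdot\rangle$ is the Hall inner product. The fake length $\ell\ell(\alpha)$ of a finite sequence $\alpha=(\alpha_1,\dots,\alpha_N)$ is its number of entries $N$, zero entries included. For such $\alpha$, $\|\alpha\| = \sum_{j=1}^{N}(N+1-j)\,\alpha_j$ (the sum of the cumulative sums $\alpha_1+\dots+\alpha_k$, $k=1,\dots,N$), computed with $N=\ell\ell(\alpha)$. $|\alpha|=\sum_j\alpha_j$. $\lambda+(n)$ denotes $\lambda$ with $n$ added to its first entry; $\nu+n\cdot\mu$ is the componentwise sum of $\nu$ and $n$ times $\mu$. -}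

module Defs where

open import Data.Nat as ℕ using (ℕ; zero; suc; _<ᵇ_; _≡ᵇ_; _≤ᵇ_)
open import Data.Integer as ℤ using (ℤ; +_; -[1+_])
open import Data.Bool using (Bool; true; false; _∧_; if_then_else_)
open import Data.List as L using (List; []; _∷_; _++_; concatMap; upTo; length; concat)
open import Data.Vec as V using (Vec; _∷_; tabulate; lookup; replicate; zipWith; toList)
open import Data.Vec.Properties using (≡-dec)
open import Data.Fin as F using (Fin; toℕ)
open import Relation.Nullary.Decidable using (isYes)

bfilter : {A : Set} → (A → Bool) → List A → List A
bfilter p [] = []
bfilter p (x ∷ xs) = if p x then x ∷ bfilter p xs else bfilter p xs

-- Semistandard Young tableaux of shape μ with entries in {0,…,N-1}
-- (0-indexed version of the alphabet {1,…,N}), as lists of rows.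

wseqs : ℕ → ℕ → ℕ → List (List ℕ)
wseqs N zero lo = [] ∷ []
wseqs N (suc m) lo =
  concatMap (λ v → L.map (v ∷_) (wseqs N m v)) (bfilter (lo ≤ᵇ_) (upTo N))

fillings : ℕ → List ℕ → List (List (List ℕ))
fillings N [] = [] ∷ []
fillings N (r ∷ rs) =
  concatMap (λ row → L.map (row ∷_) (fillings N rs)) (wseqs N r 0)

strictBelow : List ℕ → List ℕ → Bool
strictBelow (a ∷ as) (b ∷ bs) = (a <ᵇ b) ∧ strictBelow as bs
strictBelow _ _ = true

colStrict : List (List ℕ) → Bool
colStrict (r₁ ∷ r₂ ∷ rs) = strictBelow r₁ r₂ ∧ colStrict (r₂ ∷ rs)
colStrict _ = true

ssyt : (N : ℕ) → List ℕ → List (List (List ℕ))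
ssyt N sh = bfilter colStrict (fillings N sh)

content : (N : ℕ) → List (List ℕ) → Vec ℕ N
content N T = tabulate (λ i → length (bfilter (_≡ᵇ toℕ i) (concat T)))

-- Polynomials with nonnegative integer coefficients in x₁,…,x_N,
-- represented as a list of monomials (exponent vectors), i.e. a sum of
-- monomials counted with multiplicity.

Poly : ℕ → Set
Poly N = List (Vec ℕ N)

monMul : {N : ℕ} → Vec ℕ N → Vec ℕ N → Vec ℕ N
monMul = zipWith ℕ._+_

polyOne : (N : ℕ) → Poly N
polyOne N = replicate N 0 ∷ []

polyMul : {N : ℕ} → Poly N → Poly N → Poly N
polyMul p q = concatMap (λ a → L.map (monMul a) q) p

schur : (N : ℕ) → List ℕ → Poly N
schur N μ = L.map (content N) (ssyt N μ)

multisets : {A : Set} → ℕ → List A → List (List A)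
multisets zero xs = [] ∷ []
multisets (suc r) [] = []
multisets (suc r) (x ∷ xs) = L.map (x ∷_) (multisets r (x ∷ xs)) L.++ multisets (suc r) xs

-- plethysm h_r[f] for f a sum of monomials: h_r evaluated at the monomials
-- of f (with multiplicity); h_r = 0 for r < 0, h_0 = 1.
plethH : {N : ℕ} → ℤ → Poly N → Poly N
plethH {N} (+ r) f = L.map (L.foldr monMul (replicate N 0)) (multisets r f)
plethH -[1+ _ ] f = []

hPlethS : {N : ℕ} → Vec ℤ N → Vec ℕ N → Poly N
hPlethS {N} λ' μ = L.foldr polyMul (polyOne N) (L.map (λ r → plethH r (schur N (toList μ))) (toList λ'))

-- ⟨f, h_ν⟩ = coefficient of m_ν in f = coefficient of x^ν (0 if ν has a negative entry)
coeff : {N : ℕ} → Vec ℤ N → Poly N → ℕ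
coeff ν p = length (bfilter (λ m → isYes (≡-dec ℤ._≟_ (V.map +_ m) ν)) p)

-- b^ν_{λ,μ} = ⟨h_λ[s_μ], h_ν⟩  (all three of fake length N)
b : {N : ℕ} → Vec ℤ N → Vec ℕ N → Vec ℤ N → ℕ
b λ' μ ν = coeff ν (hPlethS λ' μ)

IsPartition : {N : ℕ} → Vec ℕ N → Set
IsPartition {N} μ = (i j : Fin N) → i F.≤ j → lookup μ j ℕ.≤ lookup μ i

size : {N : ℕ} → Vec ℤ N → ℤ
size α = V.foldr _ ℤ._+_ (+ 0) α

-- ‖α‖ = Σ_{j=1}^N (N+1-j) α_j  (0-indexed: Σ_i (N - i) α_i)
norm : {N : ℕ} → Vec ℤ N → ℤ
norm {N} α = V.foldr _ ℤ._+_ (+ 0) (tabulate (λ i → + (N ℕ.∸ toℕ i) ℤ.* lookup α i))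

addFirst : {k : ℕ} → Vec ℤ (suc k) → ℕ → Vec ℤ (suc k)
addFirst (x ∷ xs) n = (x ℤ.+ + n) ∷ xs

addMult : {N : ℕ} → Vec ℤ N → ℕ → Vec ℕ N → Vec ℤ N
addMult ν n μ = zipWith (λ a c → a ℤ.+ + (n ℕ.* c)) ν μ

natVec : {N : ℕ} → Vec ℕ N → Vec ℤ N
natVec = V.map +_

-- The superstandard tableau of shape μ (row i filled with i) is the only semistandard
-- tableau of content μ, and every other one has strictly smaller weighted degree
-- ‖·‖, where x_i has weight N + 1 − i.  So in s_μ = x^μ + S′ all monomials of S′ have
-- degree ≤ ‖μ‖ − 1, and splitting off the multisets that contain x^μ gives
--   h_{r+1}[s_μ] = x^μ · h_r[s_μ] + h_{r+1}[S′].
-- Taking the coefficient of x^{ν+(n+1)μ} in h_{λ₁+n+1}[s_μ] · h_{λ₂}[s_μ] ⋯, the first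
-- summand gives b at n, while the second only involves monomials of degree at most
-- (λ₁+n+1)(‖μ‖−1) + (|λ|−λ₁)‖μ‖.  Once n reaches |λ|‖μ‖ − ‖ν‖ − λ₁ this is below
-- ‖ν+(n+1)μ‖ = ‖ν‖ + (n+1)‖μ‖, so the second summand contributes nothing.
module Submission where

open import Defs
open import Data.Nat using (ℕ; suc)
open import Data.Integer using (ℤ; +_; _+_; _-_; _*_; _≤_)
open import Data.Vec using (Vec; head)
open import Relation.Binary.PropositionalEquality using (_≡_)

open import Data.Bool using (Bool; true; false; T; if_then_else_)
open import Data.Bool.Properties using (T-∧; T-≡)
open import Data.Fin as Fin using (Fin; toℕ)
open import Data.Integer as ℤ using (-[1+_])
import Data.Integer.Properties as ℤ
open import Data.Integer.Tactic.RingSolver using (solve-∀)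
open import Algebra.Properties.AbelianGroup ℤ.+-0-abelianGroup using () renaming (∙-cancelˡ to +-cancelˡ)
open import Data.List using (List; []; _∷_; _++_; map; concat; concatMap; filter; foldr; length; replicate; upTo)
import Data.List.Properties as List
open import Data.List.Membership.Propositional using (_∈_)
open import Data.List.Membership.Propositional.Properties using (∈-upTo⁺)
open import Data.List.Relation.Binary.Permutation.Propositional as ↭
  using (_↭_; ↭-refl; ↭-reflexive; ↭-trans; prep; swap; module PermutationReasoning)
open import Data.List.Relation.Binary.Permutation.Propositional.Properties
  using (↭-length; filter-↭; shifts; ++⁺ˡ; ++⁺; map⁺)
open import Data.List.Relation.Binary.Pointwise using (Pointwise; []; _∷_)
open import Data.List.Relation.Unary.All as All using (All; []; _∷_)
import Data.List.Relation.Unary.All.Properties as All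
open import Data.List.Relation.Unary.AllPairs using ([]; _∷_)
open import Data.List.Relation.Unary.Any using (here; there)
open import Data.List.Relation.Unary.Linked using (Linked; []; [-]; _∷_)
open import Data.List.Relation.Unary.Unique.Propositional using (Unique)
open import Data.List.Relation.Unary.Unique.Propositional.Properties using (upTo⁺)
open import Data.Nat as ℕ using (zero; z≤n; s≤s; z<s)
import Data.Nat.Properties as ℕ
import Data.Nat.Tactic.RingSolver as ℕ-Solver
open import Data.Nat.ListAction using (sum)
open import Data.Nat.ListAction.Properties using (sum-++)
open import Data.Product using (∃₂; _×_; _,_; proj₁)
open import Data.Sum using (_⊎_; inj₁; inj₂)
open import Data.Unit using (⊤; tt)
open import Data.Vec as Vec using ([]; _∷_; zipWith; toList; tabulate; lookup)
import Data.Vec.Properties as Vec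
open import Function using (_∘_; Equivalence; mk⇔)
open import Relation.Binary.Definitions using (DecidableEquality)
open import Relation.Binary.PropositionalEquality
  using (refl; sym; trans; cong; cong₂; subst; subst₂; _≢_; ≢-sym; _≗_; module ≡-Reasoning)
open import Relation.Nullary using (yes; no; does; contradiction)
open import Relation.Nullary.Decidable using (isYes≗does; does-⇔; T?)
open import Relation.Unary using (Decidable)

private
  variable
    A : Set
    N j : ℕ

bfilter-filter : {P : A → Set} (P? : Decidable P) (p : A → Bool) → (∀ x → p x ≡ does (P? x)) →
  bfilter p ≗ filter P?
bfilter-filter P? p p≡ [] = refl
bfilter-filter P? p p≡ (x ∷ xs) rewrite p≡ x with does (P? x)
... | true  = cong (x ∷_) (bfilter-filter P? p p≡ xs)
... | false = bfilter-filter P? p p≡ xs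

bfilter-T? : (p : A → Bool) → bfilter p ≗ filter (T? ∘ p)
bfilter-T? p = bfilter-filter (T? ∘ p) p (λ _ → refl)

length-filter-map : {B : Set} {P : A → Set} {Q : B → Set} (P? : Decidable P) (Q? : Decidable Q) (f : B → A) →
  (∀ x → does (P? (f x)) ≡ does (Q? x)) →
  (xs : List B) → length (filter P? (map f xs)) ≡ length (filter Q? xs)
length-filter-map P? Q? f eq [] = refl
length-filter-map P? Q? f eq (x ∷ xs) rewrite eq x with does (Q? x)
... | true  = cong suc (length-filter-map P? Q? f eq xs)
... | false = length-filter-map P? Q? f eq xs

count : DecidableEquality A → A → List A → ℕ
count _≟_ x xs = length (filter (_≟ x) xs)

module Occurrences {A : Set} (_≟_ : DecidableEquality A) where

  count-++ : ∀ x xs ys → count _≟_ x (xs ++ ys) ≡ count _≟_ x xs ℕ.+ count _≟_ x ys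
  count-++ x xs ys =
    trans (cong length (List.filter-++ (_≟ x) xs ys)) (List.length-++ (filter (_≟ x) xs))

  count-here : ∀ x xs → count _≟_ x (x ∷ xs) ≡ suc (count _≟_ x xs)
  count-here x xs = cong length (List.filter-accept (_≟ x) refl)

  count-there : ∀ {x y} xs → y ≢ x → count _≟_ x (y ∷ xs) ≡ count _≟_ x xs
  count-there {x} xs y≢x = cong length (List.filter-reject (_≟ x) y≢x)

  count-absent : ∀ {x xs} → All (_≢ x) xs → count _≟_ x xs ≡ 0
  count-absent {x} xs∌x = cong length (List.filter-none (_≟ x) xs∌x)

  count≡0⇒absent : ∀ {x} xs → count _≟_ x xs ≡ 0 → All (_≢ x) xs
  count≡0⇒absent [] _ = []
  count≡0⇒absent {x} (y ∷ xs) c with y ≟ x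
  count≡0⇒absent {x} (y ∷ xs) () | yes _
  ... | no y≢x = y≢x ∷ count≡0⇒absent xs c

  count-unique : ∀ {x xs} → Unique xs → x ∈ xs → count _≟_ x xs ≡ 1
  count-unique {x} {_ ∷ xs} (x∉xs ∷ _) (here refl) =
    trans (count-here x xs) (cong suc (count-absent (All.map ≢-sym x∉xs)))
  count-unique {_} {_ ∷ xs} (y∉xs ∷ u) (there x∈xs) =
    trans (count-there xs (All.lookup y∉xs x∈xs)) (count-unique u x∈xs)

  count-bfilter : ∀ {x} (p : A → Bool) → T (p x) →
    ∀ xs → count _≟_ x (bfilter p xs) ≡ count _≟_ x xs
  count-bfilter p px [] = refl
  count-bfilter {x} p px (y ∷ xs) with p y in py
  ... | true with y ≟ x
  ...   | yes _ = cong suc (count-bfilter p px xs)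
  ...   | no _  = count-bfilter p px xs
  count-bfilter {x} p px (y ∷ xs) | false with y ≟ x
  ...   | yes refl = contradiction (trans (sym py) (Equivalence.to T-≡ px)) λ ()
  ...   | no _     = count-bfilter p px xs

  count-cons : ∀ x y xs →
    count _≟_ x (y ∷ xs) ≡ (if does (y ≟ x) then 1 else 0) ℕ.+ count _≟_ x xs
  count-cons x y xs with does (y ≟ x)
  ... | true  = refl
  ... | false = refl

  count-replicate : ∀ c x → count _≟_ x (replicate c x) ≡ c
  count-replicate zero x = refl
  count-replicate (suc c) x = trans (count-here x (replicate c x)) (cong suc (count-replicate c x))

  count≡1⇒split : ∀ {x} xs → count _≟_ x xs ≡ 1 →
    ∃₂ λ as bs → xs ≡ as ++ x ∷ bs × All (_≢ x) (as ++ bs)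
  count≡1⇒split {x} (y ∷ xs) c with y ≟ x
  ... | yes refl = [] , xs , refl , count≡0⇒absent xs (ℕ.suc-injective c)
  ... | no y≢x with count≡1⇒split xs c
  ...   | as , bs , refl , others = y ∷ as , bs , refl , y≢x ∷ others

extensions : (A → List (List A)) → List A → List (List A)
extensions F = concatMap (λ v → map (v ∷_) (F v))

All-extensions : {P : A → Set} {Q : List A → Set} {F : A → List (List A)} →
  (∀ {v} → P v → All (Q ∘ (v ∷_)) (F v)) → ∀ {W} → All P W → All Q (extensions F W)
All-extensions f pW = All.concat⁺ (All.map⁺ (All.map (λ pv → All.map⁺ (f pv)) pW))

module _ {A : Set} (_≟_ : DecidableEquality A) where

  private
    _≟ₗ_ : DecidableEquality (List A)
    _≟ₗ_ = List.≡-dec _≟_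

  open Occurrences

  count-map-∷ : ∀ x xs L → count _≟ₗ_ (x ∷ xs) (map (x ∷_) L) ≡ count _≟ₗ_ xs L
  count-map-∷ x xs = length-filter-map (_≟ₗ (x ∷ xs)) (_≟ₗ xs) (x ∷_)
    (λ l → does-⇔ (mk⇔ List.∷-injectiveʳ (cong (x ∷_))) ((x ∷ l) ≟ₗ (x ∷ xs)) (l ≟ₗ xs))

  count-extensions : ∀ (F : A → List (List A)) x xs W →
    count _≟ₗ_ (x ∷ xs) (extensions F W) ≡ count _≟_ x W ℕ.* count _≟ₗ_ xs (F x)
  count-extensions F x xs [] = refl
  count-extensions F x xs (v ∷ W) with v ≟ x
  ... | yes refl = trans (count-++ _≟ₗ_ _ (map (x ∷_) (F x)) _)
                     (cong₂ ℕ._+_ (count-map-∷ x xs (F x)) (count-extensions F x xs W))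
  ... | no v≢x   = trans (count-++ _≟ₗ_ _ (map (v ∷_) (F v)) _)
                     (cong₂ ℕ._+_ none (count-extensions F x xs W))
    where
    none : count _≟ₗ_ (x ∷ xs) (map (v ∷_) (F v)) ≡ 0
    none = count-absent _≟ₗ_ {xs = map (v ∷_) (F v)}
      (All.map⁺ (All.tabulate {xs = F v} λ _ eq → v≢x (List.∷-injectiveˡ eq)))

All-delete : {P : A → Set} (as : List A) {x : A} {bs : List A} →
  All P (as ++ x ∷ bs) → All P (as ++ bs)
All-delete [] (_ ∷ pbs) = pbs
All-delete (_ ∷ as) (pa ∷ rest) = pa ∷ All-delete as rest

Dominated : (A → ℕ) → A → A → Set
Dominated f x y = x ≡ y ⊎ f x ℕ.< f y

dominated⇒≤ : {f : A → ℕ} {x y : A} → Dominated f x y → f x ℕ.≤ f y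
dominated⇒≤ (inj₁ refl) = ℕ.≤-refl
dominated⇒≤ (inj₂ fx<fy) = ℕ.<⇒≤ fx<fy

dominated-resp : {f g : A → ℕ} → (∀ x → g x ≡ f x) →
  {x y : A} → Dominated f x y → Dominated g x y
dominated-resp g≡f (inj₁ x≡y) = inj₁ x≡y
dominated-resp g≡f {x} {y} (inj₂ fx<fy) = inj₂ (subst₂ ℕ._<_ (sym (g≡f x)) (sym (g≡f y)) fx<fy)

dominated-sum : (f : A → ℕ) {xs ys : List A} →
  Pointwise (Dominated f) xs ys → Dominated (sum ∘ map f) xs ys
dominated-sum f [] = inj₁ refl
dominated-sum f (inj₂ fx<fy ∷ rest) = inj₂ (ℕ.+-mono-<-≤ fx<fy (dominated⇒≤ (dominated-sum f rest)))
dominated-sum f (inj₁ refl ∷ rest) with dominated-sum f rest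
... | inj₁ refl = inj₁ refl
... | inj₂ lt   = inj₂ (ℕ.+-monoʳ-< (f _) lt)

pointwise-replicate : {R : A → A → Set} {y : A} {xs : List A} → All (λ x → R x y) xs →
  Pointwise R xs (replicate (length xs) y)
pointwise-replicate [] = []
pointwise-replicate (r ∷ rs) = r ∷ pointwise-replicate rs

-- Monomials and their weighted degree

monMul-assoc : (a b c : Vec ℕ N) → monMul (monMul a b) c ≡ monMul a (monMul b c)
monMul-assoc = Vec.zipWith-assoc ℕ.+-assoc

monMul-leftComm : (a b c : Vec ℕ N) → monMul a (monMul b c) ≡ monMul b (monMul a c)
monMul-leftComm a b c = begin
  monMul a (monMul b c) ≡⟨ monMul-assoc a b c ⟨
  monMul (monMul a b) c ≡⟨ cong (λ ab → monMul ab c) (Vec.zipWith-comm ℕ.+-comm a b) ⟩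
  monMul (monMul b a) c ≡⟨ monMul-assoc b a c ⟩
  monMul b (monMul a c) ∎
  where open ≡-Reasoning

monProd : List (Vec ℕ N) → Vec ℕ N
monProd = foldr monMul (Vec.replicate _ 0)

‖_‖ : Vec ℕ N → ℕ
‖ [] ‖ = 0
‖_‖ {suc n} (x ∷ xs) = suc n ℕ.* x ℕ.+ ‖ xs ‖

‖‖-monMul : (a c : Vec ℕ N) → ‖ monMul a c ‖ ≡ ‖ a ‖ ℕ.+ ‖ c ‖
‖‖-monMul [] [] = refl
‖‖-monMul {suc n} (x ∷ a) (y ∷ c) =
  trans (cong (suc n ℕ.* (x ℕ.+ y) ℕ.+_) (‖‖-monMul a c)) (regroup (suc n) x y ‖ a ‖ ‖ c ‖)
  where
  regroup : ∀ k x y a c → k ℕ.* (x ℕ.+ y) ℕ.+ (a ℕ.+ c) ≡ (k ℕ.* x ℕ.+ a) ℕ.+ (k ℕ.* y ℕ.+ c)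
  regroup = ℕ-Solver.solve-∀

‖replicate-0‖ : ∀ n → ‖ Vec.replicate n 0 ‖ ≡ 0
‖replicate-0‖ zero = refl
‖replicate-0‖ (suc n) =
  trans (cong (ℕ._+ ‖ Vec.replicate n 0 ‖) (ℕ.*-zeroʳ (suc n))) (‖replicate-0‖ n)

norm-natVec : (v : Vec ℕ N) → norm (natVec v) ≡ + ‖ v ‖
norm-natVec [] = refl
norm-natVec {suc n} (x ∷ v) = begin
  + suc n * + x + norm (natVec v)  ≡⟨ cong₂ _+_ (sym (ℤ.pos-* (suc n) x)) (norm-natVec v) ⟩
  + (suc n ℕ.* x) + + ‖ v ‖       ≡⟨ ℤ.pos-+ (suc n ℕ.* x) ‖ v ‖ ⟨
  + ‖ x ∷ v ‖                      ∎
  where open ≡-Reasoning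

norm-addMult : (ν : Vec ℤ N) (n : ℕ) (μ : Vec ℕ N) → norm (addMult ν n μ) ≡ norm ν + + n * + ‖ μ ‖
norm-addMult [] n [] = sym (trans (ℤ.+-identityˡ (+ n * + 0)) (ℤ.*-zeroʳ (+ n)))
norm-addMult {suc k} (v ∷ ν) n (c ∷ μ) = begin
  + suc k * (v + + (n ℕ.* c)) + norm (addMult ν n μ)
    ≡⟨ cong₂ (λ nc r → + suc k * (v + nc) + r) (ℤ.pos-* n c) (norm-addMult ν n μ) ⟩
  + suc k * (v + + n * + c) + (norm ν + + n * + ‖ μ ‖)
    ≡⟨ regroup (+ suc k) v (+ n) (+ c) (norm ν) (+ ‖ μ ‖) ⟩
  (+ suc k * v + norm ν) + + n * (+ suc k * + c + + ‖ μ ‖)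
    ≡⟨ cong (λ m → + suc k * v + norm ν + + n * m) ‖c∷μ‖ ⟩
  (+ suc k * v + norm ν) + + n * + ‖ c ∷ μ ‖ ∎
  where
  open ≡-Reasoning
  ‖c∷μ‖ : + suc k * + c + + ‖ μ ‖ ≡ + ‖ c ∷ μ ‖
  ‖c∷μ‖ = trans (cong (_+ + ‖ μ ‖) (sym (ℤ.pos-* (suc k) c))) (sym (ℤ.pos-+ _ ‖ μ ‖))
  regroup : ∀ K v n c V M → K * (v + n * c) + (V + n * M) ≡ (K * v + V) + n * (K * c + M)
  regroup = solve-∀

natVec-monMul : (a m : Vec ℕ N) → natVec (monMul a m) ≡ zipWith _+_ (natVec a) (natVec m)
natVec-monMul [] [] = refl
natVec-monMul (x ∷ a) (y ∷ m) = cong₂ _∷_ (ℤ.pos-+ x y) (natVec-monMul a m)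

zipWith-+-cancelˡ : (u v w : Vec ℤ N) → zipWith _+_ u v ≡ zipWith _+_ u w → v ≡ w
zipWith-+-cancelˡ [] [] [] _ = refl
zipWith-+-cancelˡ (x ∷ u) (y ∷ v) (z ∷ w) eq =
  cong₂ _∷_ (+-cancelˡ x y z (Vec.∷-injectiveˡ eq)) (zipWith-+-cancelˡ u v w (Vec.∷-injectiveʳ eq))

addMult-suc : (ν : Vec ℤ N) (n : ℕ) (μ : Vec ℕ N) →
  addMult ν (suc n) μ ≡ zipWith _+_ (natVec μ) (addMult ν n μ)
addMult-suc [] n [] = refl
addMult-suc (v ∷ ν) n (c ∷ μ) = cong₂ _∷_ shift (addMult-suc ν n μ)
  where
  leftComm : ∀ v c m → v + (c + m) ≡ c + (v + m)
  leftComm = solve-∀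
  shift : v + + (c ℕ.+ n ℕ.* c) ≡ + c + (v + + (n ℕ.* c))
  shift = trans (cong (_+_ v) (ℤ.pos-+ c (n ℕ.* c))) (leftComm v (+ c) (+ (n ℕ.* c)))

-- Products of polynomials and plethysm with h_r

polyMul-++ˡ : (p q r : Poly N) → polyMul (p ++ q) r ≡ polyMul p r ++ polyMul q r
polyMul-++ˡ p q r = List.concatMap-++ (λ a → map (monMul a) r) p q

polyMul-↭ˡ : {p q : Poly N} (r : Poly N) → p ↭ q → polyMul p r ↭ polyMul q r
polyMul-↭ˡ r ↭.refl = ↭-refl
polyMul-↭ˡ r (prep a p↭q) = ++⁺ˡ (map (monMul a) r) (polyMul-↭ˡ r p↭q)
polyMul-↭ˡ r (swap a b p↭q) = ↭-trans
  (shifts (map (monMul a) r) (map (monMul b) r))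
  (++⁺ˡ (map (monMul b) r) (++⁺ˡ (map (monMul a) r) (polyMul-↭ˡ r p↭q)))
polyMul-↭ˡ r (↭.trans p↭q q↭s) = ↭-trans (polyMul-↭ˡ r p↭q) (polyMul-↭ˡ r q↭s)

map-monMul-leftComm : (a b : Vec ℕ N) (p : Poly N) →
  map (monMul a) (map (monMul b) p) ≡ map (monMul b) (map (monMul a) p)
map-monMul-leftComm a b p =
  trans (sym (List.map-∘ p)) (trans (List.map-cong (monMul-leftComm a b) p) (List.map-∘ p))

polyMul-map-monMul : (a : Vec ℕ N) (p r : Poly N) →
  polyMul (map (monMul a) p) r ≡ map (monMul a) (polyMul p r)
polyMul-map-monMul a [] r = refl
polyMul-map-monMul a (m ∷ p) r = begin
  map (monMul (monMul a m)) r ++ polyMul (map (monMul a) p) r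
    ≡⟨ cong₂ _++_ (trans (List.map-cong (monMul-assoc a m) r) (List.map-∘ r))
                  (polyMul-map-monMul a p r) ⟩
  map (monMul a) (map (monMul m) r) ++ map (monMul a) (polyMul p r)
    ≡⟨ List.map-++ (monMul a) (map (monMul m) r) _ ⟨
  map (monMul a) (polyMul (m ∷ p) r) ∎
  where open ≡-Reasoning

plethH-suc-cons : (r : ℕ) (a : Vec ℕ N) (f : Poly N) →
  plethH (+ suc r) (a ∷ f) ≡ map (monMul a) (plethH (+ r) (a ∷ f)) ++ plethH (+ suc r) f
plethH-suc-cons r a f = trans (List.map-++ monProd (map (a ∷_) M) (multisets (suc r) f))
  (cong (_++ plethH (+ suc r) f) (trans (sym (List.map-∘ M)) (List.map-∘ M)))
  where
  M = multisets r (a ∷ f)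

plethH-suc-extract : (x : Vec ℕ N) (as bs : Poly N) (r : ℕ) →
  plethH (+ suc r) (as ++ x ∷ bs) ↭
  map (monMul x) (plethH (+ r) (as ++ x ∷ bs)) ++ plethH (+ suc r) (as ++ bs)
plethH-suc-extract x [] bs r = ↭-reflexive (plethH-suc-cons r x bs)
plethH-suc-extract x (y ∷ as) bs zero = begin
  monMul y _ ∷ plethH (+ 1) (as ++ x ∷ bs)                 <⟨ plethH-suc-extract x as bs zero ⟩
  monMul y _ ∷ monMul x _ ∷ plethH (+ 1) (as ++ bs)        <<⟨ ↭-refl ⟩
  monMul x _ ∷ monMul y _ ∷ plethH (+ 1) (as ++ bs)        ∎
  where open PermutationReasoning
plethH-suc-extract x (y ∷ as) bs (suc r) = begin
  plethH (+ suc (suc r)) (y ∷ F)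
    ≡⟨ plethH-suc-cons (suc r) y F ⟩
  y· (plethH (+ suc r) (y ∷ F)) ++ plethH (+ suc (suc r)) F
    ↭⟨ ++⁺ (map⁺ (monMul y) (plethH-suc-extract x (y ∷ as) bs r)) (plethH-suc-extract x as bs (suc r)) ⟩
  y· (x· X ++ Y) ++ (x· Z ++ W)
    ≡⟨ cong (_++ (x· Z ++ W)) (List.map-++ (monMul y) (x· X) Y) ⟩
  (y· (x· X) ++ y· Y) ++ (x· Z ++ W)
    ≡⟨ List.++-assoc (y· (x· X)) (y· Y) _ ⟩
  y· (x· X) ++ (y· Y ++ (x· Z ++ W))
    ↭⟨ ++⁺ˡ (y· (x· X)) (shifts (y· Y) (x· Z)) ⟩
  y· (x· X) ++ (x· Z ++ (y· Y ++ W))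
    ≡⟨ cong (_++ (x· Z ++ (y· Y ++ W))) (map-monMul-leftComm y x X) ⟩
  x· (y· X) ++ (x· Z ++ (y· Y ++ W))
    ≡⟨ List.++-assoc (x· (y· X)) (x· Z) _ ⟨
  (x· (y· X) ++ x· Z) ++ (y· Y ++ W)
    ≡⟨ cong (_++ (y· Y ++ W)) (List.map-++ (monMul x) (y· X) Z) ⟨
  x· (y· X ++ Z) ++ (y· Y ++ W)
    ≡⟨ cong₂ _++_ (cong x· (plethH-suc-cons r y F)) (plethH-suc-cons (suc r) y (as ++ bs)) ⟨
  x· (plethH (+ suc r) (y ∷ F)) ++ plethH (+ suc (suc r)) (y ∷ as ++ bs) ∎
  where
  open PermutationReasoning
  F = as ++ x ∷ bs
  X = plethH (+ r) (y ∷ F)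
  Y = plethH (+ suc r) (y ∷ as ++ bs)
  Z = plethH (+ suc r) F
  W = plethH (+ suc (suc r)) (as ++ bs)
  x· y· : Poly _ → Poly _
  x· = map (monMul x)
  y· = map (monMul y)

plethH-extract : (x : Vec ℕ N) (as bs : Poly N) (s : ℤ) →
  plethH (+ 1 + s) (as ++ x ∷ bs) ↭
  map (monMul x) (plethH s (as ++ x ∷ bs)) ++ plethH (+ 1 + s) (as ++ bs)
plethH-extract x as bs (+ r) = plethH-suc-extract x as bs r
plethH-extract x as bs -[1+ zero ] = ↭-refl
plethH-extract x as bs -[1+ suc _ ] = ↭-refl

-- Coefficients and degree bounds

exponent? : (ν : Vec ℤ N) → Decidable (λ (m : Vec ℕ N) → natVec m ≡ ν)
exponent? ν m = Vec.≡-dec ℤ._≟_ (natVec m) ν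

coeff-filter : (ν : Vec ℤ N) (p : Poly N) → coeff ν p ≡ length (filter (exponent? ν) p)
coeff-filter ν p = cong length (bfilter-filter (exponent? ν) _ (isYes≗does ∘ exponent? ν) p)

coeff-++ : (ν : Vec ℤ N) (p q : Poly N) → coeff ν (p ++ q) ≡ coeff ν p ℕ.+ coeff ν q
coeff-++ ν p q = begin
  coeff ν (p ++ q)
    ≡⟨ coeff-filter ν (p ++ q) ⟩
  length (filter (exponent? ν) (p ++ q))
    ≡⟨ cong length (List.filter-++ (exponent? ν) p q) ⟩
  length (filter (exponent? ν) p ++ filter (exponent? ν) q)
    ≡⟨ List.length-++ (filter (exponent? ν) p) ⟩
  length (filter (exponent? ν) p) ℕ.+ length (filter (exponent? ν) q)
    ≡⟨ cong₂ ℕ._+_ (coeff-filter ν p) (coeff-filter ν q) ⟨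
  coeff ν p ℕ.+ coeff ν q ∎
  where open ≡-Reasoning

coeff-↭ : (ν : Vec ℤ N) {p q : Poly N} → p ↭ q → coeff ν p ≡ coeff ν q
coeff-↭ ν {p} {q} p↭q = begin
  coeff ν p                       ≡⟨ coeff-filter ν p ⟩
  length (filter (exponent? ν) p) ≡⟨ ↭-length (filter-↭ (exponent? ν) p↭q) ⟩
  length (filter (exponent? ν) q) ≡⟨ coeff-filter ν q ⟨
  coeff ν q                       ∎
  where open ≡-Reasoning

coeff-map-monMul : (a : Vec ℕ N) (ν : Vec ℤ N) (p : Poly N) →
  coeff (zipWith _+_ (natVec a) ν) (map (monMul a) p) ≡ coeff ν p
coeff-map-monMul a ν p = begin
  coeff aν (map (monMul a) p)
    ≡⟨ coeff-filter aν (map (monMul a) p) ⟩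
  length (filter (exponent? aν) (map (monMul a) p))
    ≡⟨ length-filter-map (exponent? aν) (exponent? ν) (monMul a) same p ⟩
  length (filter (exponent? ν) p)
    ≡⟨ coeff-filter ν p ⟨
  coeff ν p ∎
  where
  open ≡-Reasoning
  aν = zipWith _+_ (natVec a) ν
  same : ∀ m → does (exponent? aν (monMul a m)) ≡ does (exponent? ν m)
  same m = does-⇔ (mk⇔ (zipWith-+-cancelˡ (natVec a) (natVec m) ν ∘ trans (sym (natVec-monMul a m)))
                       (trans (natVec-monMul a m) ∘ cong (zipWith _+_ (natVec a))))
                  (exponent? aν (monMul a m)) (exponent? ν m)

NormAtMost : ℤ → Poly N → Set
NormAtMost B = All (λ m → + ‖ m ‖ ≤ B)

coeff-vanish : {B : ℤ} (ν : Vec ℤ N) {p : Poly N} → NormAtMost B p → B ℤ.< norm ν → coeff ν p ≡ 0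
coeff-vanish ν {p} bounded B<ν =
  trans (coeff-filter ν p) (cong length (List.filter-none (exponent? ν) (All.map absent bounded)))
  where
  absent : ∀ {m} → + ‖ m ‖ ≤ _ → natVec m ≢ ν
  absent {m} m≤B refl = ℤ.<-irrefl (sym (norm-natVec m)) (ℤ.≤-<-trans m≤B B<ν)

multisets-All : {P : A → Set} (r : ℕ) {xs : List A} → All P xs →
  All (λ ms → length ms ≡ r × All P ms) (multisets r xs)
multisets-All zero _ = (refl , []) ∷ []
multisets-All (suc r) [] = []
multisets-All (suc r) (px ∷ pxs) =
  All.++⁺ (All.map⁺ (All.map (λ (len , pms) → cong suc len , px ∷ pms) (multisets-All r (px ∷ pxs))))
          (multisets-All (suc r) pxs)

‖replicate-0‖≤ : (N : ℕ) (B : ℤ) → + ‖ Vec.replicate N 0 ‖ ≤ + 0 * B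
‖replicate-0‖≤ N B = ℤ.≤-reflexive (trans (cong +_ (‖replicate-0‖ N)) (sym (ℤ.*-zeroˡ B)))

monProd-normAtMost : {B : ℤ} {ms : Poly N} → NormAtMost B ms → + ‖ monProd ms ‖ ≤ + length ms * B
monProd-normAtMost {N} {B} [] = ‖replicate-0‖≤ N B
monProd-normAtMost {B = B} {m ∷ ms} (m≤B ∷ ms≤B) = begin
  + ‖ monMul m (monProd ms) ‖          ≡⟨ cong +_ (‖‖-monMul m (monProd ms)) ⟩
  + (‖ m ‖ ℕ.+ ‖ monProd ms ‖)         ≡⟨ ℤ.pos-+ ‖ m ‖ _ ⟩
  + ‖ m ‖ + + ‖ monProd ms ‖           ≤⟨ ℤ.+-mono-≤ m≤B (monProd-normAtMost ms≤B) ⟩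
  B + + length ms * B                  ≡⟨ ℤ.suc-* (+ length ms) B ⟨
  + suc (length ms) * B                ∎
  where open ℤ.≤-Reasoning

plethH-normAtMost : {B : ℤ} {f : Poly N} → NormAtMost B f → (z : ℤ) → NormAtMost (z * B) (plethH z f)
plethH-normAtMost {B = B} f≤B (+ r) = All.map⁺ (All.map
  (λ (len , ms≤B) → subst (λ l → _ ≤ + l * B) len (monProd-normAtMost ms≤B))
  (multisets-All r f≤B))
plethH-normAtMost f≤B -[1+ _ ] = []

polyMul-normAtMost : {B C : ℤ} {p q : Poly N} →
  NormAtMost B p → NormAtMost C q → NormAtMost (B + C) (polyMul p q)
polyMul-normAtMost {B = B} {C} p≤B q≤C =
  All.concat⁺ (All.map⁺ (All.map (λ {a} a≤B → All.map⁺ (All.map (λ {c} → bound a c a≤B) q≤C)) p≤B))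
  where
  bound : ∀ a c → + ‖ a ‖ ≤ B → + ‖ c ‖ ≤ C → + ‖ monMul a c ‖ ≤ B + C
  bound a c a≤B c≤C = subst (_≤ B + C) (sym (trans (cong +_ (‖‖-monMul a c)) (ℤ.pos-+ ‖ a ‖ ‖ c ‖)))
    (ℤ.+-mono-≤ a≤B c≤C)

hProduct : List ℤ → Poly N → Poly N
hProduct rs f = foldr polyMul (polyOne _) (map (λ r → plethH r f) rs)

hProduct-normAtMost : {B : ℤ} {f : Poly N} → NormAtMost B f →
  (rs : Vec ℤ j) → NormAtMost (size rs * B) (hProduct (toList rs) f)
hProduct-normAtMost {N} {B = B} f≤B [] = ‖replicate-0‖≤ N B ∷ []
hProduct-normAtMost {B = B} f≤B (r ∷ rs) =
  subst (λ C → NormAtMost C _) (sym (ℤ.*-distribʳ-+ B r (size rs)))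
    (polyMul-normAtMost (plethH-normAtMost f≤B r) (hProduct-normAtMost f≤B rs))

UniqueHeaviest : Vec ℕ N → Poly N → Set
UniqueHeaviest a S = ∃₂ λ as bs → S ≡ as ++ a ∷ bs × All (λ m → ‖ m ‖ ℕ.< ‖ a ‖) (as ++ bs)

uniqueHeaviest-normAtMost : {a : Vec ℕ N} {S : Poly N} → UniqueHeaviest a S → NormAtMost (+ ‖ a ‖) S
uniqueHeaviest-normAtMost (as , bs , refl , lighter) =
  let as< , bs< = All.++⁻ as lighter
  in All.++⁺ (All.map weaken as<) (ℤ.≤-refl ∷ All.map weaken bs<)
  where
  weaken : ∀ {m n} → m ℕ.< n → + m ≤ + n
  weaken = ℤ.+≤+ ∘ ℕ.<⇒≤

coeff-plethH-step : {a : Vec ℕ N} {S : Poly N} → UniqueHeaviest a S →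
  {B : ℤ} {R : Poly N} → NormAtMost B R → (s : ℤ) (ν : Vec ℤ N) →
  (+ 1 + s) * ℤ.pred (+ ‖ a ‖) + B ℤ.< norm (zipWith _+_ (natVec a) ν) →
  coeff (zipWith _+_ (natVec a) ν) (polyMul (plethH (+ 1 + s) S) R) ≡ coeff ν (polyMul (plethH s S) R)
coeff-plethH-step {a = a} (as , bs , refl , lighter) {R = R} R≤B s ν small = begin
  coeff aν (polyMul (plethH (+ 1 + s) S) R)
    ≡⟨ coeff-↭ aν (polyMul-↭ˡ R (plethH-extract a as bs s)) ⟩
  coeff aν (polyMul (map (monMul a) P ++ rest) R)
    ≡⟨ cong (coeff aν) (polyMul-++ˡ (map (monMul a) P) rest R) ⟩
  coeff aν (polyMul (map (monMul a) P) R ++ polyMul rest R)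
    ≡⟨ coeff-++ aν (polyMul (map (monMul a) P) R) (polyMul rest R) ⟩
  coeff aν (polyMul (map (monMul a) P) R) ℕ.+ coeff aν (polyMul rest R)
    ≡⟨ cong₂ ℕ._+_ (cong (coeff aν) (polyMul-map-monMul a P R)) rest-vanishes ⟩
  coeff aν (map (monMul a) (polyMul P R)) ℕ.+ 0
    ≡⟨ trans (ℕ.+-identityʳ _) (coeff-map-monMul a ν (polyMul P R)) ⟩
  coeff ν (polyMul P R) ∎
  where
  open ≡-Reasoning
  S = as ++ a ∷ bs
  P = plethH s S
  aν = zipWith _+_ (natVec a) ν
  rest = plethH (+ 1 + s) (as ++ bs)
  rest≤ : NormAtMost (ℤ.pred (+ ‖ a ‖)) (as ++ bs)
  rest≤ = All.map (ℤ.i<j⇒i≤pred[j] ∘ ℤ.+<+) lighter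
  rest-vanishes : coeff aν (polyMul rest R) ≡ 0
  rest-vanishes = coeff-vanish aν (polyMul-normAtMost (plethH-normAtMost rest≤ (+ 1 + s)) R≤B) small

-- Contents of tableaux

tabulate-+ : {n : ℕ} (f g : Fin n → ℕ) →
  tabulate (λ i → f i ℕ.+ g i) ≡ monMul (tabulate f) (tabulate g)
tabulate-+ {zero} f g = refl
tabulate-+ {suc n} f g = cong (f Fin.zero ℕ.+ g Fin.zero ∷_) (tabulate-+ (f ∘ Fin.suc) (g ∘ Fin.suc))

‖tabulate-0‖ : ∀ n → ‖ tabulate {n = n} (λ _ → 0) ‖ ≡ 0
‖tabulate-0‖ zero = refl
‖tabulate-0‖ (suc n) =
  trans (cong (ℕ._+ ‖ tabulate {n = n} (λ _ → 0) ‖) (ℕ.*-zeroʳ (suc n))) (‖tabulate-0‖ n)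

indicator : {n : ℕ} → ℕ → Fin n → ℕ
indicator e i = if does (e ℕ.≟ toℕ i) then 1 else 0

‖indicator‖ : ∀ n e → ‖ tabulate {n = n} (indicator e) ‖ ≡ n ℕ.∸ e
‖indicator‖ zero e = sym (ℕ.0∸n≡0 e)
‖indicator‖ (suc n) zero =
  trans (cong₂ ℕ._+_ (ℕ.*-identityʳ (suc n)) (‖tabulate-0‖ n)) (ℕ.+-identityʳ (suc n))
‖indicator‖ (suc n) (suc e) =
  trans (cong (ℕ._+ ‖ tabulate {n = n} (indicator e) ‖) (ℕ.*-zeroʳ (suc n))) (‖indicator‖ n e)

-- Truncated subtraction makes this hold for every list: an entry e ≥ n is counted
-- by no coordinate and contributes n ∸ e = 0.
‖tabulate-count‖ : ∀ {n} es →
  ‖ tabulate {n = n} (λ i → count ℕ._≟_ (toℕ i) es) ‖ ≡ sum (map (n ℕ.∸_) es)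
‖tabulate-count‖ {n} [] = ‖tabulate-0‖ n
‖tabulate-count‖ {n} (e ∷ es) = begin
  ‖ tabulate {n = n} (λ i → count ℕ._≟_ (toℕ i) (e ∷ es)) ‖
    ≡⟨ cong ‖_‖ (Vec.tabulate-cong {n = n} (λ i → Occurrences.count-cons ℕ._≟_ (toℕ i) e es)) ⟩
  ‖ tabulate {n = n} (λ i → indicator e i ℕ.+ count ℕ._≟_ (toℕ i) es) ‖
    ≡⟨ cong ‖_‖ (tabulate-+ {n} (indicator e) (λ i → count ℕ._≟_ (toℕ i) es)) ⟩
  ‖ monMul (tabulate {n = n} (indicator e)) (tabulate {n = n} (λ i → count ℕ._≟_ (toℕ i) es)) ‖
    ≡⟨ ‖‖-monMul (tabulate {n = n} (indicator e)) _ ⟩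
  ‖ tabulate {n = n} (indicator e) ‖ ℕ.+ ‖ tabulate {n = n} (λ i → count ℕ._≟_ (toℕ i) es) ‖
    ≡⟨ cong₂ ℕ._+_ (‖indicator‖ n e) (‖tabulate-count‖ es) ⟩
  (n ℕ.∸ e) ℕ.+ sum (map (n ℕ.∸_) es) ∎
  where open ≡-Reasoning

content-count : (τ : List (List ℕ)) →
  content N τ ≡ tabulate (λ i → count ℕ._≟_ (toℕ i) (concat τ))
content-count τ = Vec.tabulate-cong λ i →
  cong length (bfilter-filter (ℕ._≟ toℕ i) (ℕ._≡ᵇ toℕ i) (λ _ → refl) (concat τ))

superstandard : ℕ → List ℕ → List (List ℕ)
superstandard i [] = []
superstandard i (c ∷ cs) = replicate c i ∷ superstandard (suc i) cs

superstandard-entries : ∀ j cs → All (j ℕ.≤_) (concat (superstandard j cs))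
superstandard-entries j [] = []
superstandard-entries j (c ∷ cs) = All.++⁺ (All.replicate⁺ c ℕ.≤-refl)
  (All.map (ℕ.≤-trans (ℕ.n≤1+n j)) (superstandard-entries (suc j) cs))

count-superstandard : ∀ {n} j (v : Vec ℕ n) (i : Fin n) →
  count ℕ._≟_ (j ℕ.+ toℕ i) (concat (superstandard j (toList v))) ≡ lookup v i
count-superstandard j (x ∷ v) Fin.zero rewrite ℕ.+-identityʳ j = begin
  count ℕ._≟_ j (replicate x j ++ rest)
    ≡⟨ Occurrences.count-++ ℕ._≟_ j (replicate x j) rest ⟩
  count ℕ._≟_ j (replicate x j) ℕ.+ count ℕ._≟_ j rest
    ≡⟨ cong₂ ℕ._+_ (Occurrences.count-replicate ℕ._≟_ x j) (Occurrences.count-absent ℕ._≟_ later) ⟩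
  x ℕ.+ 0
    ≡⟨ ℕ.+-identityʳ x ⟩
  x ∎
  where
  open ≡-Reasoning
  rest = concat (superstandard (suc j) (toList v))
  later : All (_≢ j) rest
  later = All.map (λ j<e j≡e → ℕ.<-irrefl (sym j≡e) j<e) (superstandard-entries (suc j) (toList v))
count-superstandard j (x ∷ v) (Fin.suc i) rewrite ℕ.+-suc j (toℕ i) = begin
  count ℕ._≟_ (suc j ℕ.+ toℕ i) (replicate x j ++ rest)
    ≡⟨ Occurrences.count-++ ℕ._≟_ _ (replicate x j) rest ⟩
  count ℕ._≟_ (suc j ℕ.+ toℕ i) (replicate x j) ℕ.+ count ℕ._≟_ (suc j ℕ.+ toℕ i) rest
    ≡⟨ cong (ℕ._+ _) (Occurrences.count-absent ℕ._≟_ earlier) ⟩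
  count ℕ._≟_ (suc j ℕ.+ toℕ i) rest
    ≡⟨ count-superstandard (suc j) v i ⟩
  lookup v i ∎
  where
  open ≡-Reasoning
  rest = concat (superstandard (suc j) (toList v))
  earlier : All (_≢ suc j ℕ.+ toℕ i) (replicate x j)
  earlier = All.replicate⁺ x (ℕ.<⇒≢ (s≤s (ℕ.m≤m+n j (toℕ i))))

content-superstandard : (μ : Vec ℕ N) → content N (superstandard 0 (toList μ)) ≡ μ
content-superstandard μ = trans (content-count (superstandard 0 (toList μ)))
  (trans (Vec.tabulate-cong (count-superstandard 0 μ)) (Vec.tabulate∘lookup μ))

-- Semistandard tableaux

module Tableaux (N : ℕ) where

  SortedFrom : ℕ → List ℕ → Set
  SortedFrom lo [] = ⊤
  SortedFrom lo (v ∷ vs) = lo ℕ.≤ v × v ℕ.< N × SortedFrom v vs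

  Row : ℕ → ℕ → List ℕ → Set
  Row lo c r = length r ≡ c × SortedFrom lo r

  data Rows : ℕ → List ℕ → List (List ℕ) → Set where
    []  : ∀ {i} → Rows i [] []
    _∷_ : ∀ {i c cs r rs} → Row i c r → Rows (suc i) cs rs → Rows i (c ∷ cs) (r ∷ rs)

  wseqs-rows : ∀ m lo → All (Row lo m) (wseqs N m lo)
  wseqs-rows zero lo = (refl , tt) ∷ []
  wseqs-rows (suc m) lo = All-extensions extend candidates
    where
    extend : ∀ {v} → lo ℕ.≤ v × v ℕ.< N → All (Row lo (suc m) ∘ (v ∷_)) (wseqs N m v)
    extend {v} (lo≤v , v<N) = All.map (λ (len , sorted) → cong suc len , lo≤v , v<N , sorted) (wseqs-rows m v)
    candidates : All (λ v → lo ℕ.≤ v × v ℕ.< N) (bfilter (lo ℕ.≤ᵇ_) (upTo N))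
    candidates = subst (All _) (sym (bfilter-T? (lo ℕ.≤ᵇ_) (upTo N)))
      (All.zipWith (λ {v} (v<N , lo≤v) → ℕ.≤ᵇ⇒≤ lo v lo≤v , v<N)
        (All.filter⁺ (T? ∘ (lo ℕ.≤ᵇ_)) (All.all-upTo N) , All.all-filter (T? ∘ (lo ℕ.≤ᵇ_)) (upTo N)))

  fillings-rows : ∀ sh → All (Pointwise (Row 0) sh) (fillings N sh)
  fillings-rows [] = [] ∷ []
  fillings-rows (c ∷ cs) = All-extensions (λ row → All.map (row ∷_) (fillings-rows cs)) (wseqs-rows c 0)

  ssyt-rows : ∀ sh → All (λ τ → Pointwise (Row 0) sh τ × T (colStrict τ)) (ssyt N sh)
  ssyt-rows sh = subst (All _) (sym (bfilter-T? colStrict (fillings N sh)))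
    (All.zip (All.filter⁺ (T? ∘ colStrict) (fillings-rows sh) ,
              All.all-filter (T? ∘ colStrict) (fillings N sh)))

  -- Column strictness is only needed between the first entries of consecutive rows.
  sorted-below : ∀ {i} r {r′} → length r′ ℕ.≤ length r → T (strictBelow r r′) →
    SortedFrom i r → SortedFrom 0 r′ → SortedFrom (suc i) r′
  sorted-below _ {[]} _ _ _ _ = tt
  sorted-below [] {_ ∷ _} () _ _ _
  sorted-below (a ∷ _) {b ∷ _} _ below (i≤a , _) (_ , b<N , sorted) =
    ℕ.≤-<-trans i≤a (ℕ.<ᵇ⇒< a b (proj₁ (Equivalence.to T-∧ below))) , b<N , sorted

  colStrict⇒Rows-∷ : ∀ {i c cs r rs} → Linked ℕ._≥_ (c ∷ cs) → Row i c r →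
    Pointwise (Row 0) cs rs → T (colStrict (r ∷ rs)) → Rows i (c ∷ cs) (r ∷ rs)
  colStrict⇒Rows-∷ _ row [] _ = row ∷ []
  colStrict⇒Rows-∷ {r = r} (c≥c′ ∷ shape) (len , sorted) ((len′ , sorted′) ∷ rows) strict =
    let below , strict′ = Equivalence.to T-∧ strict
        shorter = subst₂ ℕ._≤_ (sym len′) (sym len) c≥c′
        row′ = len′ , sorted-below r shorter below sorted sorted′
    in (len , sorted) ∷ colStrict⇒Rows-∷ shape row′ rows strict′

  colStrict⇒Rows : ∀ {sh τ} → Linked ℕ._≥_ sh → Pointwise (Row 0) sh τ → T (colStrict τ) →
    Rows 0 sh τ
  colStrict⇒Rows _ [] _ = []
  colStrict⇒Rows shape (row ∷ rows) strict = colStrict⇒Rows-∷ shape row rows strict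

  weight : List ℕ → ℕ
  weight es = sum (map (N ℕ.∸_) es)

  weight-concat : (τ : List (List ℕ)) → weight (concat τ) ≡ sum (map weight τ)
  weight-concat [] = refl
  weight-concat (r ∷ τ) = trans (cong sum (List.map-++ (N ℕ.∸_) r (concat τ)))
    (trans (sum-++ (map (N ℕ.∸_) r) _) (cong (weight r ℕ.+_) (weight-concat τ)))

  ‖content‖ : (τ : List (List ℕ)) → ‖ content N τ ‖ ≡ sum (map weight τ)
  ‖content‖ τ =
    trans (cong ‖_‖ (content-count {N} τ)) (trans (‖tabulate-count‖ {N} (concat τ)) (weight-concat τ))

  sorted-bounds : ∀ {lo} r → SortedFrom lo r → All (λ e → lo ℕ.≤ e × e ℕ.< N) r
  sorted-bounds [] _ = []
  sorted-bounds (e ∷ r) (lo≤e , e<N , sorted) =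
    (lo≤e , e<N) ∷ All.map (λ (e≤x , x<N) → ℕ.≤-trans lo≤e e≤x , x<N) (sorted-bounds r sorted)

  entry-dominated : ∀ {i e} → i ℕ.≤ e → e ℕ.< N → Dominated (N ℕ.∸_) e i
  entry-dominated i≤e e<N with ℕ.m≤n⇒m<n∨m≡n i≤e
  ... | inj₁ i<e  = inj₂ (ℕ.∸-monoʳ-< i<e (ℕ.<⇒≤ e<N))
  ... | inj₂ refl = inj₁ refl

  row-dominated : ∀ {i} r → SortedFrom i r → Dominated weight r (replicate (length r) i)
  row-dominated r sorted = dominated-sum (N ℕ.∸_)
    (pointwise-replicate (All.map (λ (i≤e , e<N) → entry-dominated i≤e e<N) (sorted-bounds r sorted)))

  rows-dominated : ∀ {i sh τ} → Rows i sh τ → Pointwise (Dominated weight) τ (superstandard i sh)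
  rows-dominated [] = []
  rows-dominated ((refl , sorted) ∷ rows) = row-dominated _ sorted ∷ rows-dominated rows

  ssyt-dominated : ∀ {sh} → Linked ℕ._≥_ sh →
    All (λ τ → Dominated (‖_‖ ∘ content N) τ (superstandard 0 sh)) (ssyt N sh)
  ssyt-dominated shape = All.map
    (λ (rows , strict) →
       dominated-resp ‖content‖ (dominated-sum weight (rows-dominated (colStrict⇒Rows shape rows strict))))
    (ssyt-rows _)

  private
    _≟ᵣ_ : DecidableEquality (List ℕ)
    _≟ᵣ_ = List.≡-dec ℕ._≟_

    _≟ₜ_ : DecidableEquality (List (List ℕ))
    _≟ₜ_ = List.≡-dec _≟ᵣ_

  count-wseqs : ∀ c {lo j} → lo ℕ.≤ j → j ℕ.< N → count _≟ᵣ_ (replicate c j) (wseqs N c lo) ≡ 1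
  count-wseqs zero _ _ = refl
  count-wseqs (suc c) {lo} {j} lo≤j j<N = begin
    count _≟ᵣ_ (j ∷ replicate c j) (extensions (wseqs N c) candidates)
      ≡⟨ count-extensions ℕ._≟_ (wseqs N c) j (replicate c j) candidates ⟩
    count ℕ._≟_ j candidates ℕ.* count _≟ᵣ_ (replicate c j) (wseqs N c j)
      ≡⟨ cong₂ ℕ._*_ j-once (count-wseqs c ℕ.≤-refl j<N) ⟩
    1 ∎
    where
    open ≡-Reasoning
    candidates = bfilter (lo ℕ.≤ᵇ_) (upTo N)
    j-once : count ℕ._≟_ j candidates ≡ 1
    j-once = trans (Occurrences.count-bfilter ℕ._≟_ (lo ℕ.≤ᵇ_) (ℕ.≤⇒≤ᵇ lo≤j) (upTo N))
                   (Occurrences.count-unique ℕ._≟_ (upTo⁺ N) (∈-upTo⁺ j<N))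

  count-fillings : ∀ i sh → i ℕ.+ length sh ℕ.≤ N →
    count _≟ₜ_ (superstandard i sh) (fillings N sh) ≡ 1
  count-fillings i [] _ = refl
  count-fillings i (c ∷ cs) fits =
    trans (count-extensions _≟ᵣ_ (λ _ → fillings N cs) (replicate c i) _ (wseqs N c 0))
          (cong₂ ℕ._*_ (count-wseqs c z≤n (ℕ.<-≤-trans (ℕ.m<m+n i z<s) fits))
                       (count-fillings (suc i) cs (subst (ℕ._≤ N) (ℕ.+-suc i (length cs)) fits)))

  strictBelow-replicate : ∀ i c d → T (strictBelow (replicate c i) (replicate d (suc i)))
  strictBelow-replicate i zero d = tt
  strictBelow-replicate i (suc c) zero = tt
  strictBelow-replicate i (suc c) (suc d) =
    Equivalence.from T-∧ (ℕ.<⇒<ᵇ (ℕ.n<1+n i) , strictBelow-replicate i c d)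

  superstandard-colStrict : ∀ i sh → T (colStrict (superstandard i sh))
  superstandard-colStrict i [] = tt
  superstandard-colStrict i (c ∷ []) = tt
  superstandard-colStrict i (c ∷ d ∷ cs) =
    Equivalence.from T-∧ (strictBelow-replicate i c d , superstandard-colStrict (suc i) (d ∷ cs))

  count-ssyt : ∀ sh → length sh ℕ.≤ N → count _≟ₜ_ (superstandard 0 sh) (ssyt N sh) ≡ 1
  count-ssyt sh fits =
    trans (Occurrences.count-bfilter _≟ₜ_ colStrict (superstandard-colStrict 0 sh) (fillings N sh))
          (count-fillings 0 sh fits)

isPartition-linked : (μ : Vec ℕ N) → IsPartition μ → Linked ℕ._≥_ (toList μ)
isPartition-linked [] _ = []
isPartition-linked (x ∷ []) _ = [-]
isPartition-linked (x ∷ y ∷ μ) decreasing =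
  decreasing Fin.zero (Fin.suc Fin.zero) z≤n ∷
  isPartition-linked (y ∷ μ) (λ i j i≤j → decreasing (Fin.suc i) (Fin.suc j) (s≤s i≤j))

schur-uniqueHeaviest : (μ : Vec ℕ N) → IsPartition μ → UniqueHeaviest μ (schur N (toList μ))
schur-uniqueHeaviest {N} μ isPartition
  with Occurrences.count≡1⇒split (List.≡-dec (List.≡-dec ℕ._≟_)) (ssyt N (toList μ))
         (Tableaux.count-ssyt N (toList μ) (ℕ.≤-reflexive (Vec.length-toList μ)))
... | as , bs , ssyt≡ , others = map (content N) as , map (content N) bs , schur≡ , lighter
  where
  open ≡-Reasoning
  σ = superstandard 0 (toList μ)

  schur≡ : map (content N) (ssyt N (toList μ)) ≡ map (content N) as ++ μ ∷ map (content N) bs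
  schur≡ = begin
    map (content N) (ssyt N (toList μ))            ≡⟨ cong (map (content N)) ssyt≡ ⟩
    map (content N) (as ++ σ ∷ bs)                 ≡⟨ List.map-++ (content N) as (σ ∷ bs) ⟩
    map (content N) as ++ content N σ ∷ map (content N) bs
      ≡⟨ cong (λ m → map (content N) as ++ m ∷ map (content N) bs) (content-superstandard μ) ⟩
    map (content N) as ++ μ ∷ map (content N) bs   ∎

  strict : ∀ {τ} → τ ≢ σ × Dominated (‖_‖ ∘ content N) τ σ → ‖ content N τ ‖ ℕ.< ‖ μ ‖
  strict (τ≢σ , inj₁ τ≡σ) = contradiction τ≡σ τ≢σ
  strict (_ , inj₂ lighter) = subst (_ ℕ.<_) (cong ‖_‖ (content-superstandard μ)) lighter

  lighter : All (λ m → ‖ m ‖ ℕ.< ‖ μ ‖) (map (content N) as ++ map (content N) bs)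
  lighter = subst (All _) (List.map-++ (content N) as bs) (All.map⁺ (All.zipWith strict (others , dominated)))
    where
    dominated = All-delete as
      (subst (All _) ssyt≡ (Tableaux.ssyt-dominated N (isPartition-linked μ isPartition)))

-- Stability

threshold-bound : ∀ (x X ν M n : ℤ) → (x + X) * M - ν - x ≤ n →
  (+ 1 + (x + n)) * ℤ.pred M + X * M ℤ.< ν + (+ 1 + n) * M
threshold-bound x X ν M n past = ℤ.suc[i]≤j⇒i<j (begin
  + 1 + lhs                ≡⟨ ℤ.+-identityʳ (+ 1 + lhs) ⟨
  + 1 + lhs + + 0          ≤⟨ ℤ.+-monoʳ-≤ (+ 1 + lhs) (ℤ.i≤j⇒0≤j-i past) ⟩
  + 1 + lhs + (n - ((x + X) * M - ν - x)) ≡⟨ identity x X ν M n ⟩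
  ν + (+ 1 + n) * M        ∎)
  where
  open ℤ.≤-Reasoning
  lhs = (+ 1 + (x + n)) * ℤ.pred M + X * M
  -- ℤ.pred M is written out as -[1+ 0 ] + M so that the solver can see through it.
  identity : ∀ x X ν M n →
    + 1 + ((+ 1 + (x + n)) * (-[1+ 0 ] + M) + X * M) + (n - ((x + X) * M - ν - x)) ≡ ν + (+ 1 + n) * M
  identity = solve-∀

b-stable-step : {k : ℕ} (μ : Vec ℕ (suc k)) → IsPartition μ →
  (x : ℤ) (xs : Vec ℤ k) (ν : Vec ℤ (suc k)) (n : ℕ) →
  size (x ∷ xs) * norm (natVec μ) - norm ν - x ≤ + n →
  b (addFirst (x ∷ xs) (suc n)) μ (addMult ν (suc n) μ) ≡ b (addFirst (x ∷ xs) n) μ (addMult ν n μ)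
b-stable-step {k} μ isPartition x xs ν n past = begin
  coeff (addMult ν (suc n) μ) (polyMul (plethH (x + + suc n) S) R)
    ≡⟨ cong₂ (λ w z → coeff w (polyMul (plethH z S) R)) (addMult-suc ν n μ) (x+[1+n] x (+ n)) ⟩
  coeff (zipWith _+_ (natVec μ) (addMult ν n μ)) (polyMul (plethH (+ 1 + (x + + n)) S) R)
    ≡⟨ coeff-plethH-step heaviest R≤ (x + + n) (addMult ν n μ) small ⟩
  coeff (addMult ν n μ) (polyMul (plethH (x + + n) S) R) ∎
  where
  open ≡-Reasoning
  S = schur (suc k) (toList μ)
  R = hProduct (toList xs) S
  heaviest = schur-uniqueHeaviest μ isPartition
  R≤ : NormAtMost (size xs * + ‖ μ ‖) R
  R≤ = hProduct-normAtMost (uniqueHeaviest-normAtMost heaviest) xs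
  x+[1+n] : ∀ x n → x + (+ 1 + n) ≡ + 1 + (x + n)
  x+[1+n] = solve-∀
  past′ : (x + size xs) * + ‖ μ ‖ - norm ν - x ≤ + n
  past′ = subst (λ M → (x + size xs) * M - norm ν - x ≤ + n) (norm-natVec μ) past
  small : (+ 1 + (x + + n)) * ℤ.pred (+ ‖ μ ‖) + size xs * + ‖ μ ‖ ℤ.<
          norm (zipWith _+_ (natVec μ) (addMult ν n μ))
  small = subst (_ ℤ.<_) (trans (sym (norm-addMult ν (suc n) μ)) (cong norm (addMult-suc ν n μ)))
    (threshold-bound x (size xs) (norm ν) (+ ‖ μ ‖) (+ n) past′)

stable-from : (t : ℤ) (f : ℕ → A) → (∀ n → t ≤ + n → f (suc n) ≡ f n) →
  ∀ {m n} → t ≤ + m → m ℕ.≤′ n → f n ≡ f m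
stable-from t f step t≤m ℕ.≤′-refl = refl
stable-from t f step t≤m (ℕ.≤′-step m≤′n) =
  trans (step _ (ℤ.≤-trans t≤m (ℤ.+≤+ (ℕ.≤′⇒≤ m≤′n)))) (stable-from t f step t≤m m≤′n)

constant-from : (t : ℤ) (f : ℕ → A) → (∀ n → t ≤ + n → f (suc n) ≡ f n) →
  ∀ {m n} → t ≤ + m → t ≤ + n → f m ≡ f n
constant-from t f step {m} {n} t≤m t≤n with ℕ.≤-total m n
... | inj₁ m≤n = sym (stable-from t f step t≤m (ℕ.≤⇒≤′ m≤n))
... | inj₂ n≤m = stable-from t f step t≤n (ℕ.≤⇒≤′ n≤m)

theorem3p1 : (k : ℕ) (μ : Vec ℕ (suc k)) (λ' ν : Vec ℤ (suc k)) → IsPartition μ →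
    (m n : ℕ) →
    size λ' * norm (natVec μ) - norm ν - head λ' ≤ + m →
    size λ' * norm (natVec μ) - norm ν - head λ' ≤ + n →
    b (addFirst λ' m) μ (addMult ν m μ) ≡ b (addFirst λ' n) μ (addMult ν n μ)
theorem3p1 k μ (x ∷ xs) ν isPartition m n past-m past-n =
  constant-from _ (λ n → b (addFirst (x ∷ xs) n) μ (addMult ν n μ))
    (b-stable-step μ isPartition x xs ν) past-m past-n
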